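{- Let $V$ be a set of $n+1$ positive integers ($n\ge0$). The map $\mathrm{SP}$ is a bijection between the set of all valid digraphs on $V$ consisting only of backward arrows and the set of all Schröder words of length $2n$.
   Context: For a finite node set $V\subseteq\mathbb{P}$, an arrow $(x,y)$ with $x\ne y$ in $V$ has tail $x$, head $y$; it is forward if $x<y$, backward if $x>y$; its interval is $\{\min(x,y),\ldots,\max(x,y)\}$. Two arrows cross if their intervals $[a_1,a_2]$, $[b_1,b_2]$ satisfy $a_1<b_1<a_2<b_2$ or $b_1<a_1<b_2<a_2$; an arrow nests another if its interval contains the other's; two arrows nest if one nests the other. A valid digraph on $V$ is a set $A$ of arrows on $V$ such that: (1) no two arrows cross; (2) any two forward arrows nest; (3) no backward arrow nests a forward arrow; (4) no head of an arrow is the tail of another arrow. For $W\subseteq V$, $A_W$ denotes the arrows of $A$ with both endpoints in $W$, a digraph on $W$. Words in letters $U$, $D$ (length 1) and $H$ (length 2) encode lattice paths with steps $(1,1)$, $(1,-1)$, $(2,0)$. A Schröder word of length $2n$ is a word of total length $2n$ encoding a path from $(0,0)$ to $(2n,0)$ never going below the horizontal axis. $\epsilon$ is the empty word and $\cdot$ is concatenation. $\mathrm{SP}$: for a valid digraph $A$ of backward arrows on nonempty $V$ with $v=\min V$: if $V=\{v\}$, $\mathrm{SP}(A)=\epsilon$; if $v$ lies on no arrow of $A$, $\mathrm{SP}(A)=H\cdot\mathrm{SP}(A_{V-\{v\}})$; otherwise let $w=\min\{x\in V:(x,v)\in A\}$ and $\mathrm{SP}(A)=U\cdot\mathrm{SP}(A_{V\cap(v,w]})\cdot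 D\cdot\mathrm{SP}(A_{V-(v,w]})$. -}

module Defs where

open import Data.Nat using (ℕ; zero; suc; _+_; _*_; _≤_; _<_; _⊔_; _⊓_; _≡ᵇ_; _<ᵇ_; _≤ᵇ_)
open import Data.Bool using (Bool; true; false; not; _∧_; _∨_; if_then_else_)
open import Data.List using (List; []; _∷_; _++_; length; filterᵇ)
open import Data.Bool.ListAction using (any)
open import Data.List.Relation.Unary.All using (All)
open import Data.List.Membership.Propositional using (_∈_)
open import Data.Maybe using (Maybe; just; nothing)
open import Data.Product using (_×_; _,_; proj₁; proj₂)
open import Data.Sum using (_⊎_)
open import Data.Empty using (⊥)
open import Relation.Nullary using (¬_)
open import Relation.Binary.PropositionalEquality using (_≡_; _≢_)

Arrow : Set
Arrow = ℕ × ℕ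

tail : Arrow → ℕ
tail = proj₁

head : Arrow → ℕ
head = proj₂

Forward : Arrow → Set
Forward a = tail a < head a

Backward : Arrow → Set
Backward a = head a < tail a

lo hi : Arrow → ℕ
lo a = tail a ⊓ head a
hi a = tail a ⊔ head a

Cross : Arrow → Arrow → Set
Cross a b = (lo a < lo b × lo b < hi a × hi a < hi b)
          ⊎ (lo b < lo a × lo a < hi b × hi b < hi a)

Nests : Arrow → Arrow → Set
Nests a b = lo a ≤ lo b × hi b ≤ hi a

Nest : Arrow → Arrow → Set
Nest a b = Nests a b ⊎ Nests b a

-- A digraph on V is a finite set of arrows, represented by a list
-- (only membership matters).
ArrowsOn : List ℕ → List Arrow → Set
ArrowsOn V A = ∀ a → a ∈ A → tail a ∈ V × head a ∈ V × tail a ≢ head a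

ValidDigraph : List ℕ → List Arrow → Set
ValidDigraph V A =
    ArrowsOn V A
  × (∀ a b → a ∈ A → b ∈ A → ¬ Cross a b)
  × (∀ a b → a ∈ A → b ∈ A → Forward a → Forward b → Nest a b)
  × (∀ a b → a ∈ A → b ∈ A → Backward a → Forward b → ¬ Nests a b)
  × (∀ a b → a ∈ A → b ∈ A → a ≢ b → head a ≢ tail b)

BackwardValidDigraph : List ℕ → List Arrow → Set
BackwardValidDigraph V A = ValidDigraph V A × All Backward A

data Letter : Set where
  U D H : Letter

Word : Set
Word = List Letter

ε : Word
ε = []

wlen : Word → ℕ
wlen [] = 0
wlen (U ∷ w) = suc (wlen w)
wlen (D ∷ w) = suc (wlen w)
wlen (H ∷ w) = 2 + wlen w

-- PathFrom h w : the path encoded by w, started at height h, never goes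
-- below the horizontal axis and ends at height 0.
PathFrom : ℕ → Word → Set
PathFrom h [] = h ≡ 0
PathFrom h (U ∷ w) = PathFrom (suc h) w
PathFrom zero (D ∷ w) = ⊥
PathFrom (suc h) (D ∷ w) = PathFrom h w
PathFrom h (H ∷ w) = PathFrom h w

Schroder : ℕ → Word → Set
Schroder n w = wlen w ≡ 2 * n × PathFrom 0 w

memᵇ : ℕ → List ℕ → Bool
memᵇ x V = any (x ≡ᵇ_) V

restrict : List ℕ → List Arrow → List Arrow
restrict W A = filterᵇ (λ a → memᵇ (tail a) W ∧ memᵇ (head a) W) A

onArrow : ℕ → List Arrow → Bool
onArrow v A = any (λ a → (tail a ≡ᵇ v) ∨ (head a ≡ᵇ v)) A

isArrow : ℕ → ℕ → List Arrow → Bool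
isArrow x y A = any (λ a → (tail a ≡ᵇ x) ∧ (head a ≡ᵇ y)) A

first : List ℕ → Maybe ℕ
first [] = nothing
first (x ∷ _) = just x

-- SP with fuel; V is assumed to be listed in strictly increasing order,
-- so that min V is the first entry.  The fuel (length V) is always enough.
SP′ : ℕ → List ℕ → List Arrow → Word
SP′ zero _ _ = ε
SP′ (suc k) [] A = ε
SP′ (suc k) (v ∷ []) A = ε
SP′ (suc k) (v ∷ V′@(_ ∷ _)) A with onArrow v A
... | false = H ∷ SP′ k V′ (restrict V′ A)
... | true with first (filterᵇ (λ x → isArrow x v A) (v ∷ V′))
...   | nothing = ε
...   | just w = U ∷ SP′ k Vin (restrict Vin A) ++ D ∷ SP′ k Vout (restrict Vout A)
  where
  inI : ℕ → Bool
  inI x = (v <ᵇ x) ∧ (x ≤ᵇ w)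
  Vin  = filterᵇ inI (v ∷ V′)
  Vout = filterᵇ (λ x → not (inI x)) (v ∷ V′)

SP : List ℕ → List Arrow → Word
SP V A = SP′ (length V) V A

-- Let v = min V. Otherwise let w be the least
-- tail of an arrow into v. Since arrows do not cross and no head is a tail, every other arrow lies
-- inside V ∩ (v, w] or inside V - (v, w], so A is (w , v) together with its two restrictions; and
-- conversely (w , v) glues any two backward valid digraphs on these parts into one on V. Hence, by
-- induction on |V|, SP(A) = U · SP(A_in) · D · SP(A_out) is a Schröder word of length 2(|V| - 1),
-- the two factors are recovered from the word as the part before its first return to the axis and
-- the part after it (injectivity), and every Schröder word U · s · D · t is reached by gluing
-- preimages of s and t (surjectivity).
module Submission where

open import Defs
open import Data.Nat using (ℕ; zero; suc; _+_; _*_; _≤_; _<_; z≤n; s≤s; _≡ᵇ_; _<ᵇ_; _≤ᵇ_)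
open import Data.Nat.Properties
  using ( ≡ᵇ⇒≡; ≡⇒≡ᵇ; <ᵇ⇒<; <⇒<ᵇ; ≤ᵇ⇒≤; ≤⇒≤ᵇ; suc-injective; +-comm; +-suc; *-suc
        ; +-cancelˡ-≡; *-cancelˡ-≡; m≥n⇒m⊓n≡n; m≥n⇒m⊔n≡m; ≤-refl; ≤-trans; ≤-pred; <-irrefl
        ; <-asym; <-trans; <-≤-trans; <⇒≤; <⇒≱; >⇒≢; m<n⇒m<1+n; m<m+n; m≤n⇒m<n∨m≡n )
open import Data.Nat.Tactic.RingSolver using (solve-∀)
open import Data.Bool using (Bool; true; false; T; not; _∧_)
open import Data.Bool.Properties using (T-≡; T-∧; T-∨)
open import Data.List using (List; []; _∷_; _++_; _∷ʳ_; length; filter; filterᵇ)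
open import Data.List.Properties
  using ( filter-++; filter-all; filter-none; filter-accept; filter-reject; length-++
        ; ∷-injective; ∷-injectiveˡ; ∷-injectiveʳ; ++-identityʳ; ++-conicalʳ )
open import Data.List.Relation.Unary.All as All using (All; []; _∷_)
open import Data.List.Relation.Unary.All.Properties as All using ()
open import Data.List.Relation.Unary.Any as Any using (here; there)
open import Data.List.Relation.Unary.Any.Properties using (any⁺; any⁻)
open import Data.List.Relation.Unary.AllPairs as AllPairs using (AllPairs; []; _∷_)
open import Data.List.Relation.Unary.AllPairs.Properties as AllPairs using ()
open import Data.List.Relation.Unary.Linked using (Linked)
open import Data.List.Relation.Unary.Linked.Properties using (Linked⇒AllPairs)
open import Data.List.Membership.Propositional using (_∈_; _∉_; find; lose)
open import Data.List.Membership.Propositional.Properties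
  using (∈-++⁺ˡ; ∈-++⁺ʳ; ∈-++⁻; ∈-filter⁺; ∈-filter⁻)
open import Data.List.Relation.Binary.Subset.Propositional using (_⊆_)
open import Data.Maybe using (just; nothing)
open import Data.Product as Product using (_×_; _,_; proj₁; proj₂; ∃; ∃₂)
open import Data.Sum using (_⊎_; inj₁; inj₂; [_,_]′)
open import Data.Empty using (⊥; ⊥-elim)
open import Function using (id; _∘_; case_of_; _⇔_; mk⇔; Equivalence)
open import Relation.Nullary using (¬_; contradiction)
open import Relation.Nullary.Decidable using (T?)
open import Relation.Binary.PropositionalEquality
  using (_≡_; _≢_; refl; sym; trans; cong; cong₂; subst; subst₂; module ≡-Reasoning)

¬T⇒≡false : ∀ {b} → ¬ T b → b ≡ false
¬T⇒≡false {false} _  = refl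
¬T⇒≡false {true}  ¬t = contradiction _ ¬t

T-not⁺ : ∀ {b} → ¬ T b → T (not b)
T-not⁺ {false} _  = _
T-not⁺ {true}  ¬t = ¬t _

T-not⁻ : ∀ {b} → T b → ¬ T (not b)
T-not⁻ {true} _ ()

memᵇ⁺ : ∀ {x V} → x ∈ V → T (memᵇ x V)
memᵇ⁺ {x} = any⁺ _ ∘ Any.map (λ {y} → ≡⇒≡ᵇ x y)

memᵇ⁻ : ∀ {x V} → T (memᵇ x V) → x ∈ V
memᵇ⁻ {x} {V} = Any.map (λ {y} → ≡ᵇ⇒≡ x y) ∘ any⁻ _ V

isArrow⁺ : ∀ {x y A} → (x , y) ∈ A → T (isArrow x y A)
isArrow⁺ {x} {y} = any⁺ _ ∘ Any.map λ { refl → Equivalence.from T-∧ (≡⇒≡ᵇ x x refl , ≡⇒≡ᵇ y y refl) }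

isArrow⁻ : ∀ {x y A} → T (isArrow x y A) → (x , y) ∈ A
isArrow⁻ {x} {y} {A} = Any.map matches ∘ any⁻ _ A
  where
  matches : ∀ {a} → T ((tail a ≡ᵇ x) ∧ (head a ≡ᵇ y)) → (x , y) ≡ a
  matches {t , h} test with Equivalence.to T-∧ test
  ... | t≡x , h≡y = sym (cong₂ _,_ (≡ᵇ⇒≡ t x t≡x) (≡ᵇ⇒≡ h y h≡y))

Touches : ℕ → Arrow → Set
Touches v a = tail a ≡ v ⊎ head a ≡ v

onArrow⁺ : ∀ {v a A} → a ∈ A → Touches v a → T (onArrow v A)
onArrow⁺ {v} a∈A touches =
  any⁺ _ (lose a∈A (Equivalence.from T-∨ ([ inj₁ ∘ ≡⇒≡ᵇ _ v , inj₂ ∘ ≡⇒≡ᵇ _ v ]′ touches)))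

onArrow⁻ : ∀ {v A} → T (onArrow v A) → ∃ λ a → a ∈ A × Touches v a
onArrow⁻ {v} {A} test with find (any⁻ _ A test)
... | a , a∈A , touches = a , a∈A , [ inj₁ ∘ ≡ᵇ⇒≡ _ v , inj₂ ∘ ≡ᵇ⇒≡ _ v ]′ (Equivalence.to T-∨ touches)

Within : List ℕ → Arrow → Set
Within W a = tail a ∈ W × head a ∈ W

onArrow-outside : ∀ {v W A} → v ∉ W → (∀ {a} → a ∈ A → Within W a) → onArrow v A ≡ false
onArrow-outside v∉ within = ¬T⇒≡false λ test → case onArrow⁻ test of λ where
  (_ , a∈A , inj₁ refl) → v∉ (proj₁ (within a∈A))
  (_ , a∈A , inj₂ refl) → v∉ (proj₂ (within a∈A))

memᵇ-within⁺ : ∀ {W a} → Within W a → T (memᵇ (tail a) W ∧ memᵇ (head a) W)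
memᵇ-within⁺ (t∈ , h∈) = Equivalence.from T-∧ (memᵇ⁺ t∈ , memᵇ⁺ h∈)

memᵇ-within⁻ : ∀ {W a} → T (memᵇ (tail a) W ∧ memᵇ (head a) W) → Within W a
memᵇ-within⁻ = Product.map memᵇ⁻ memᵇ⁻ ∘ Equivalence.to T-∧

∈-restrict⁺ : ∀ W {A a} → a ∈ A → Within W a → a ∈ restrict W A
∈-restrict⁺ W a∈A = ∈-filter⁺ (T? ∘ _) a∈A ∘ memᵇ-within⁺

∈-restrict⁻ : ∀ W {A a} → a ∈ restrict W A → a ∈ A × Within W a
∈-restrict⁻ W = Product.map₂ memᵇ-within⁻ ∘ ∈-filter⁻ (T? ∘ _)

restrict-all : ∀ W {A} → (∀ {a} → a ∈ A → Within W a) → restrict W A ≡ A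
restrict-all W within = filter-all (T? ∘ _) (All.tabulate (memᵇ-within⁺ ∘ within))

restrict-none : ∀ W {A} → (∀ {a} → a ∈ A → ¬ Within W a) → restrict W A ≡ []
restrict-none W outside = filter-none (T? ∘ _) (All.tabulate λ a∈A → outside a∈A ∘ memᵇ-within⁻)

restrict-++ : ∀ W A B → restrict W (A ++ B) ≡ restrict W A ++ restrict W B
restrict-++ W = filter-++ (T? ∘ _)

module _ (f : ℕ → Bool) where

  first-filterᵇ-just : ∀ xs {w} → first (filterᵇ f xs) ≡ just w →
    ∃₂ λ P Q → xs ≡ P ++ w ∷ Q × All (¬_ ∘ T ∘ f) P × T (f w)
  first-filterᵇ-just (x ∷ xs) found with f x in fx
  first-filterᵇ-just (x ∷ xs) refl | true = [] , xs , refl , [] , Equivalence.from T-≡ fx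
  ... | false with first-filterᵇ-just xs found
  ... | P , Q , refl , before , fw = x ∷ P , Q , refl , subst T fx ∷ before , fw

  first-filterᵇ-++ : ∀ P {w} Q → All (¬_ ∘ T ∘ f) P → T (f w) → first (filterᵇ f (P ++ w ∷ Q)) ≡ just w
  first-filterᵇ-++ []      Q []             fw rewrite Equivalence.to T-≡ fw = refl
  first-filterᵇ-++ (_ ∷ P) Q (¬fp ∷ before) fw rewrite ¬T⇒≡false ¬fp = first-filterᵇ-++ P Q before fw

  first-filterᵇ-nothing : ∀ xs {y} → first (filterᵇ f xs) ≡ nothing → y ∈ xs → ¬ T (f y)
  first-filterᵇ-nothing xs none y∈ fy with filterᵇ f xs | ∈-filter⁺ (T? ∘ f) y∈ fy
  first-filterᵇ-nothing xs () y∈ fy | _ ∷ _ | _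

Crossing : Arrow → Arrow → Set
Crossing a b = head a < head b × head b < tail a × tail a < tail b

Cross-backward : ∀ {a b} → Backward a → Backward b → Cross a b ≡ (Crossing a b ⊎ Crossing b a)
Cross-backward ba bb
  rewrite m≥n⇒m⊓n≡n (<⇒≤ ba) | m≥n⇒m⊔n≡m (<⇒≤ ba) | m≥n⇒m⊓n≡n (<⇒≤ bb) | m≥n⇒m⊔n≡m (<⇒≤ bb) = refl

record BackwardValid (V : List ℕ) (A : List Arrow) : Set where
  field
    within      : ∀ {a} → a ∈ A → Within V a
    backward    : ∀ {a} → a ∈ A → Backward a
    noncrossing : ∀ {a b} → a ∈ A → b ∈ A → ¬ Crossing a b
    headNotTail : ∀ {a b} → a ∈ A → b ∈ A → a ≢ b → head a ≢ tail b

  tail∈ : ∀ {a} → a ∈ A → tail a ∈ V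
  tail∈ = proj₁ ∘ within

  head∈ : ∀ {a} → a ∈ A → head a ∈ V
  head∈ = proj₂ ∘ within

BackwardValidDigraph⇒BackwardValid : ∀ {V A} → BackwardValidDigraph V A → BackwardValid V A
BackwardValidDigraph⇒BackwardValid ((on , noCross , _ , _ , headNotTail) , backward) = record
  { within      = λ a∈A → proj₁ (on _ a∈A) , proj₁ (proj₂ (on _ a∈A))
  ; backward    = All.lookup backward
  ; noncrossing = λ a∈A b∈A c → noCross _ _ a∈A b∈A
      (subst id (sym (Cross-backward (All.lookup backward a∈A) (All.lookup backward b∈A))) (inj₁ c))
  ; headNotTail = headNotTail _ _
  }

BackwardValid⇒BackwardValidDigraph : ∀ {V A} → BackwardValid V A → BackwardValidDigraph V A
BackwardValid⇒BackwardValidDigraph valid =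
  ( (λ _ a∈A → tail∈ a∈A , head∈ a∈A , >⇒≢ (backward a∈A))
  , (λ _ _ a∈A b∈A c → [ noncrossing a∈A b∈A , noncrossing b∈A a∈A ]′
                          (subst id (Cross-backward (backward a∈A) (backward b∈A)) c))
  , (λ _ _ a∈A _ forward _ → ⊥-elim (<-asym forward (backward a∈A)))
  , (λ _ _ _ b∈A _ forward _ → <-asym forward (backward b∈A))
  , (λ _ _ → headNotTail) )
  , All.tabulate backward
  where open BackwardValid valid

BackwardValid-⊆ : ∀ {V W A B} → BackwardValid V A → B ⊆ A → (∀ {a} → a ∈ B → Within W a) →
  BackwardValid W B
BackwardValid-⊆ valid B⊆A within′ = record
  { within      = within′
  ; backward    = backward ∘ B⊆A
  ; noncrossing = λ a∈B b∈B → noncrossing (B⊆A a∈B) (B⊆A b∈B)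
  ; headNotTail = λ a∈B b∈B → headNotTail (B⊆A a∈B) (B⊆A b∈B)
  }
  where open BackwardValid valid

BackwardValid-restrict : ∀ {V A} W → BackwardValid V A → BackwardValid W (restrict W A)
BackwardValid-restrict {A = A} W valid =
  BackwardValid-⊆ valid (proj₁ ∘ ∈-restrict⁻ W {A}) (proj₂ ∘ ∈-restrict⁻ W {A})

BackwardValid-[] : ∀ {V} → BackwardValid V []
BackwardValid-[] = record { within = λ () ; backward = λ () ; noncrossing = λ () ; headNotTail = λ () }

BackwardValid-singleton : ∀ {v A a} → BackwardValid (v ∷ []) A → a ∉ A
BackwardValid-singleton valid a∈A with BackwardValid.within valid a∈A
... | here t≡v , here h≡v = <-irrefl (trans h≡v (sym t≡v)) (BackwardValid.backward valid a∈A)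

Increasing : List ℕ → Set
Increasing = AllPairs _<_

Increasing-head∉ : ∀ {v V} → Increasing (v ∷ V) → v ∉ V
Increasing-head∉ (v< ∷ _) v∈V = <-irrefl refl (All.lookup v< v∈V)

Increasing-head≤ : ∀ {v V y} → Increasing (v ∷ V) → y ∈ v ∷ V → v ≤ y
Increasing-head≤ _        (here refl) = ≤-refl
Increasing-head≤ (v< ∷ _) (there y∈V) = <⇒≤ (All.lookup v< y∈V)

min-not-tail : ∀ {v V A a} → Increasing (v ∷ V) → BackwardValid (v ∷ V) A → a ∈ A → tail a ≢ v
min-not-tail increasing valid a∈A refl =
  <⇒≱ (BackwardValid.backward valid a∈A) (Increasing-head≤ increasing (BackwardValid.head∈ valid a∈A))

AllPairs-++⁻ : ∀ {a r} {A : Set a} {R : A → A → Set r} xs {ys} → AllPairs R (xs ++ ys) →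
  AllPairs R xs × AllPairs R ys × All (λ x → All (R x) ys) xs
AllPairs-++⁻ []       pairs        = [] , pairs , []
AllPairs-++⁻ (x ∷ xs) (Rx ∷ pairs) with AllPairs-++⁻ xs pairs
... | pxs , pys , across = All.++⁻ˡ xs Rx ∷ pxs , pys , All.++⁻ʳ xs Rx ∷ across

module _ {a} {A : Set a} where

  length-∷ʳ : ∀ (xs : List A) y → length (xs ∷ʳ y) ≡ suc (length xs)
  length-∷ʳ xs y = trans (length-++ xs) (+-comm (length xs) 1)

  ∷ʳ-shorter : ∀ x xs y (ys : List A) → length (xs ∷ʳ y) < length (x ∷ xs ++ y ∷ ys)
  ∷ʳ-shorter x []       y ys = s≤s (s≤s z≤n)
  ∷ʳ-shorter x (_ ∷ xs) y ys = s≤s (∷ʳ-shorter x xs y ys)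

  ∷-shorter : ∀ (x : A) xs y ys → length (x ∷ ys) < length (x ∷ xs ++ y ∷ ys)
  ∷-shorter x []       y ys = ≤-refl
  ∷-shorter x (_ ∷ xs) y ys = m<n⇒m<1+n (∷-shorter x xs y ys)

  ∷ʳ⊆ : ∀ x xs y (ys : List A) → xs ∷ʳ y ⊆ x ∷ xs ++ y ∷ ys
  ∷ʳ⊆ x xs y ys z∈ with ∈-++⁻ xs z∈
  ... | inj₁ z∈xs        = there (∈-++⁺ˡ z∈xs)
  ... | inj₂ (here refl) = there (∈-++⁺ʳ xs (here refl))

  ∷⊆ : ∀ (x : A) xs y ys → x ∷ ys ⊆ x ∷ xs ++ y ∷ ys
  ∷⊆ x xs y ys (here refl) = here refl
  ∷⊆ x xs y ys (there z∈)  = there (∈-++⁺ʳ xs (there z∈))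

  ++-∷-injective : ∀ (xs₁ xs₂ : List A) {y₁ y₂ ys₁ ys₂} → length xs₁ ≡ length xs₂ →
    xs₁ ++ y₁ ∷ ys₁ ≡ xs₂ ++ y₂ ∷ ys₂ → xs₁ ≡ xs₂ × y₁ ≡ y₂ × ys₁ ≡ ys₂
  ++-∷-injective []         []         _   eq with ∷-injective eq
  ... | refl , refl = refl , refl , refl
  ++-∷-injective (x₁ ∷ xs₁) (x₂ ∷ xs₂) len eq with ∷-injective eq
  ... | refl , eq′ with ++-∷-injective xs₁ xs₂ (suc-injective len) eq′
  ... | refl , refl , refl = refl , refl , refl

  split-at : ∀ i (xs : List A) → i < length xs →
    ∃₂ λ ys y → ∃ λ zs → xs ≡ ys ++ y ∷ zs × length ys ≡ i
  split-at zero    (x ∷ xs) _         = [] , x , xs , refl , refl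
  split-at (suc i) (x ∷ xs) (s≤s i<) with split-at i xs i<
  ... | ys , y , zs , refl , refl = x ∷ ys , y , zs , refl , refl

-- In V = v ∷ P ++ w ∷ Q, P ∷ʳ w is the paper's V ∩ (v, w] and v ∷ Q is V - (v, w].
record IncreasingSplit (v : ℕ) (P : List ℕ) (w : ℕ) (Q : List ℕ) : Set where
  field
    v<P    : All (v <_) P
    P<w    : All (_< w) P
    v<w    : v < w
    w<Q    : All (w <_) Q
    inner↑ : Increasing (P ∷ʳ w)
    outer↑ : Increasing (v ∷ Q)

increasing-split : ∀ {v} P {w Q} → Increasing (v ∷ P ++ w ∷ Q) → IncreasingSplit v P w Q
increasing-split P (v< ∷ increasing) with All.++⁻ P v< | AllPairs-++⁻ P increasing
... | v<P , v<w ∷ v<Q | P↑ , w<Q ∷ Q↑ , P<wQ = record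
  { v<P    = v<P
  ; P<w    = All.map All.head P<wQ
  ; v<w    = v<w
  ; w<Q    = w<Q
  ; inner↑ = AllPairs.++⁺ P↑ ([] ∷ []) (All.map (λ p<wQ → All.head p<wQ ∷ []) P<wQ)
  ; outer↑ = v<Q ∷ Q↑
  }

between : ℕ → ℕ → ℕ → Bool
between v w y = (v <ᵇ y) ∧ (y ≤ᵇ w)

between⁺ : ∀ {v w y} → v < y → y ≤ w → T (between v w y)
between⁺ v<y y≤w = Equivalence.from T-∧ (<⇒<ᵇ v<y , ≤⇒≤ᵇ y≤w)

between⁻ : ∀ {v w y} → T (between v w y) → v < y × y ≤ w
between⁻ {v} {w} {y} test with Equivalence.to T-∧ test
... | v<y , y≤w = <ᵇ⇒< v y v<y , ≤ᵇ⇒≤ y w y≤w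

module _ {v P w Q} (split : IncreasingSplit v P w Q) where
  open IncreasingSplit split

  inner-bounds : ∀ {y} → y ∈ P ∷ʳ w → v < y × y ≤ w
  inner-bounds y∈ with ∈-++⁻ P y∈
  ... | inj₁ y∈P         = All.lookup v<P y∈P , <⇒≤ (All.lookup P<w y∈P)
  ... | inj₂ (here refl) = v<w , ≤-refl

  outer-bounds : ∀ {y} → y ∈ v ∷ Q → y ≡ v ⊎ w < y
  outer-bounds (here refl)  = inj₁ refl
  outer-bounds (there y∈Q) = inj₂ (All.lookup w<Q y∈Q)

  inner∉outer : ∀ {y} → y ∈ P ∷ʳ w → y ∉ v ∷ Q
  inner∉outer y∈inner y∈outer with inner-bounds y∈inner | outer-bounds y∈outer
  ... | v<y , _   | inj₁ refl = <-irrefl refl v<y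
  ... | _   , y≤w | inj₂ w<y  = <⇒≱ w<y y≤w

  inner-or-outer : ∀ {y} → y ∈ v ∷ P ++ w ∷ Q → y ∈ P ∷ʳ w ⊎ y ∈ v ∷ Q
  inner-or-outer (here refl) = inj₂ (here refl)
  inner-or-outer (there y∈) with ∈-++⁻ P y∈
  ... | inj₁ y∈P          = inj₁ (∈-++⁺ˡ y∈P)
  ... | inj₂ (here refl)  = inj₁ (∈-++⁺ʳ P (here refl))
  ... | inj₂ (there y∈Q) = inj₂ (there y∈Q)

  private
    v∉ : ¬ T (between v w v)
    v∉ = <-irrefl refl ∘ proj₁ ∘ between⁻ {v} {w}

    w∈ : T (between v w w)
    w∈ = between⁺ v<w ≤-refl

    P∈ : All (T ∘ between v w) P
    P∈ = All.zipWith (λ (v<y , y<w) → between⁺ v<y (<⇒≤ y<w)) (v<P , P<w)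

    Q∉ : All (¬_ ∘ T ∘ between v w) Q
    Q∉ = All.map (λ w<y → <⇒≱ w<y ∘ proj₂ ∘ between⁻) w<Q

  filterᵇ-between : filterᵇ (between v w) (v ∷ P ++ w ∷ Q) ≡ P ∷ʳ w
  filterᵇ-between = begin
      filter in? (v ∷ P ++ w ∷ Q)              ≡⟨ filter-reject in? {v} {P ++ w ∷ Q} v∉ ⟩
      filter in? (P ++ w ∷ Q)                  ≡⟨ filter-++ in? P (w ∷ Q) ⟩
      filter in? P ++ filter in? (w ∷ Q)
        ≡⟨ cong₂ _++_ (filter-all in? P∈) (filter-accept in? {w} {Q} w∈) ⟩
      P ++ w ∷ filter in? Q                    ≡⟨ cong (λ ys → P ++ w ∷ ys) (filter-none in? Q∉) ⟩
      P ∷ʳ w                                   ∎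
    where
    open ≡-Reasoning
    in? = T? ∘ between v w

  filterᵇ-not-between : filterᵇ (not ∘ between v w) (v ∷ P ++ w ∷ Q) ≡ v ∷ Q
  filterᵇ-not-between = begin
      filter out? (v ∷ P ++ w ∷ Q)             ≡⟨ filter-accept out? {v} {P ++ w ∷ Q} (T-not⁺ v∉) ⟩
      v ∷ filter out? (P ++ w ∷ Q)             ≡⟨ cong (v ∷_) (filter-++ out? P (w ∷ Q)) ⟩
      v ∷ filter out? P ++ filter out? (w ∷ Q)
        ≡⟨ cong (v ∷_) (cong₂ _++_ (filter-none out? (All.map T-not⁻ P∈)) (filter-reject out? {w} {Q} (T-not⁻ w∈))) ⟩
      v ∷ filter out? Q                        ≡⟨ cong (v ∷_) (filter-all out? (All.map T-not⁺ Q∉)) ⟩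
      v ∷ Q                                    ∎
    where
    open ≡-Reasoning
    out? = T? ∘ not ∘ between v w

wlen-++ : ∀ s t → wlen (s ++ t) ≡ wlen s + wlen t
wlen-++ []      t = refl
wlen-++ (U ∷ s) t = cong suc (wlen-++ s t)
wlen-++ (D ∷ s) t = cong suc (wlen-++ s t)
wlen-++ (H ∷ s) t = cong (2 +_) (wlen-++ s t)

PathFrom-++ : ∀ m {h} s {t} → PathFrom m s → PathFrom h t → PathFrom (m + h) (s ++ t)
PathFrom-++ m       []      refl  path₂ = path₂
PathFrom-++ m       (U ∷ s) path₁ path₂ = PathFrom-++ (suc m) s path₁ path₂
PathFrom-++ zero    (D ∷ s) ()    path₂
PathFrom-++ (suc m) (D ∷ s) path₁ path₂ = PathFrom-++ m s path₁ path₂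
PathFrom-++ m       (H ∷ s) path₁ path₂ = PathFrom-++ m s path₁ path₂

PathFrom-even : ∀ m s → PathFrom m s → ∃ λ j → m + wlen s ≡ 2 * j
PathFrom-even m [] refl = 0 , refl
PathFrom-even m (U ∷ s) path with PathFrom-even (suc m) s path
... | j , eq = j , trans (+-suc m (wlen s)) eq
PathFrom-even (suc m) (D ∷ s) path with PathFrom-even m s path
... | j , eq = suc j , trans (cong suc (+-suc m (wlen s))) (trans (cong (2 +_) eq) (sym (*-suc 2 j)))
PathFrom-even m (H ∷ s) path with PathFrom-even m s path
... | j , eq = suc j , trans (shift m (wlen s)) (trans (cong (2 +_) eq) (sym (*-suc 2 j)))
  where
  shift : ∀ m n → m + (2 + n) ≡ 2 + (m + n)
  shift = solve-∀

-- The first step down from height d + 1 + m to height m.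
first-return : ∀ m d r → PathFrom (d + suc m) r →
  ∃₂ λ s t → r ≡ s ++ D ∷ t × PathFrom d s × PathFrom m t
first-return m zero    []      ()
first-return m (suc d) []      ()
first-return m d       (U ∷ r) path with first-return m (suc d) r path
... | s , t , refl , path₁ , path₂ = U ∷ s , t , refl , path₁ , path₂
first-return m zero    (D ∷ r) path = [] , r , refl , refl , path
first-return m (suc d) (D ∷ r) path with first-return m d r path
... | s , t , refl , path₁ , path₂ = D ∷ s , t , refl , path₁ , path₂
first-return m d       (H ∷ r) path with first-return m d r path
... | s , t , refl , path₁ , path₂ = H ∷ s , t , refl , path₁ , path₂

first-return-unique : ∀ m s s′ {t t′} → PathFrom m s → PathFrom m s′ →
  s ++ D ∷ t ≡ s′ ++ D ∷ t′ → s ≡ s′ × t ≡ t′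
first-return-unique m []      []       _    _     eq = refl , ∷-injectiveʳ eq
first-return-unique m []      (c ∷ s′) refl path′ eq with ∷-injectiveˡ eq
... | refl = ⊥-elim path′
first-return-unique m (c ∷ s) []       path refl  eq with ∷-injectiveˡ eq
... | refl = ⊥-elim path
first-return-unique m (c ∷ s) (_ ∷ s′) path path′ eq with ∷-injectiveˡ eq | ∷-injectiveʳ eq
first-return-unique m       (U ∷ s) (_ ∷ s′) path path′ _ | refl | eq =
  Product.map₁ (cong (U ∷_)) (first-return-unique (suc m) s s′ path path′ eq)
first-return-unique zero    (D ∷ s) (_ ∷ s′) ()   path′ _ | refl | eq
first-return-unique (suc m) (D ∷ s) (_ ∷ s′) path path′ _ | refl | eq =
  Product.map₁ (cong (D ∷_)) (first-return-unique m s s′ path path′ eq)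
first-return-unique m       (H ∷ s) (_ ∷ s′) path path′ _ | refl | eq =
  Product.map₁ (cong (H ∷_)) (first-return-unique m s s′ path path′ eq)

Schroder-zero : ∀ {s} → Schroder 0 s → s ≡ []
Schroder-zero {[]}    _ = refl
Schroder-zero {U ∷ _} (() , _)
Schroder-zero {D ∷ _} (() , _)
Schroder-zero {H ∷ _} (() , _)

Schroder-H : ∀ {n s} → Schroder n s → Schroder (suc n) (H ∷ s)
Schroder-H {n} (len , path) = trans (cong (2 +_) len) (sym (*-suc 2 n)) , path

Schroder-H⁻ : ∀ {n s} → Schroder (suc n) (H ∷ s) → Schroder n s
Schroder-H⁻ {n} (len , path) = suc-injective (suc-injective (trans len (*-suc 2 n))) , path

Schroder-UD : ∀ {i j s t} → Schroder i s → Schroder j t → Schroder (i + suc j) (U ∷ s ++ D ∷ t)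
Schroder-UD {i} {j} {s} {t} (len₁ , path₁) (len₂ , path₂) = len , PathFrom-++ 0 s path₁ path₂
  where
  arithmetic : ∀ i j → suc (2 * i + suc (2 * j)) ≡ 2 * (i + suc j)
  arithmetic = solve-∀
  len : wlen (U ∷ s ++ D ∷ t) ≡ 2 * (i + suc j)
  len = trans (cong suc (wlen-++ s (D ∷ t)))
              (trans (cong₂ (λ m n → suc (m + suc n)) len₁ len₂) (arithmetic i j))

Schroder-UD⁻ : ∀ {n r} → Schroder n (U ∷ r) →
  ∃₂ λ i j → ∃₂ λ s t → r ≡ s ++ D ∷ t × Schroder i s × Schroder j t × i + suc j ≡ n
Schroder-UD⁻ {r = r} (len , path) with first-return 0 0 r path
... | s , t , refl , path₁ , path₂ with PathFrom-even 0 s path₁ | PathFrom-even 0 t path₂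
... | i , len₁ | j , len₂ =
  i , j , s , t , refl , (len₁ , path₁) , (len₂ , path₂) ,
  *-cancelˡ-≡ _ _ 2 (trans (sym (proj₁ (Schroder-UD {i} {j} {s} {t} (len₁ , path₁) (len₂ , path₂)))) len)

Schroder-UD-injective : ∀ {i i′ s s′ t t′} → Schroder i s → Schroder i′ s′ →
  U ∷ s ++ D ∷ t ≡ U ∷ s′ ++ D ∷ t′ → i ≡ i′ × s ≡ s′ × t ≡ t′
Schroder-UD-injective {s = s} {s′} (len , path) (len′ , path′) eq
  with first-return-unique 0 s s′ path path′ (∷-injectiveʳ eq)
... | refl , refl = *-cancelˡ-≡ _ _ 2 (trans (sym len) len′) , refl , refl

UD-word : ℕ → List ℕ → List ℕ → List Arrow → Word
UD-word k Vin Vout A = U ∷ SP′ k Vin (restrict Vin A) ++ D ∷ SP′ k Vout (restrict Vout A)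

SP′-isolated : ∀ k {v x xs A} → v ∉ x ∷ xs → (∀ {a} → a ∈ A → Within (x ∷ xs) a) →
  SP′ (suc k) (v ∷ x ∷ xs) A ≡ H ∷ SP′ k (x ∷ xs) A
SP′-isolated k {x = x} {xs} v∉ within
  rewrite onArrow-outside v∉ within | restrict-all (x ∷ xs) within = refl

SP′-enclosed : ∀ k {v} P {w Q A} → IncreasingSplit v P w Q → T (onArrow v A) →
  first (filterᵇ (λ y → isArrow y v A) (v ∷ P ++ w ∷ Q)) ≡ just w →
  SP′ (suc k) (v ∷ P ++ w ∷ Q) A ≡ UD-word k (P ∷ʳ w) (v ∷ Q) A
SP′-enclosed k {v} P {w} {Q} {A} split touched found =
  trans (unfold P found)
        (cong₂ (λ Vin Vout → UD-word k Vin Vout A) (filterᵇ-between split) (filterᵇ-not-between split))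
  where
  unfold : ∀ P → first (filterᵇ (λ y → isArrow y v A) (v ∷ P ++ w ∷ Q)) ≡ just w →
    SP′ (suc k) (v ∷ P ++ w ∷ Q) A
      ≡ UD-word k (filterᵇ (between v w) (v ∷ P ++ w ∷ Q)) (filterᵇ (not ∘ between v w) (v ∷ P ++ w ∷ Q)) A
  unfold []      found rewrite Equivalence.to T-≡ touched | found = refl
  unfold (_ ∷ _) found rewrite Equivalence.to T-≡ touched | found = refl

data SPView (k v : ℕ) (V : List ℕ) (A : List Arrow) : Set where
  single   : V ≡ [] → SPView k v V A
  isolated : ∀ {x xs} → V ≡ x ∷ xs → BackwardValid V A →
             SP′ (suc k) (v ∷ V) A ≡ H ∷ SP′ k V A → SPView k v V A
  enclosed : ∀ P w Q → V ≡ P ++ w ∷ Q → (w , v) ∈ A → (∀ {y} → y ∈ P → (y , v) ∉ A) →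
             SP′ (suc k) (v ∷ V) A ≡ UD-word k (P ∷ʳ w) (v ∷ Q) A → SPView k v V A

spView : ∀ k {v V A} → Increasing (v ∷ V) → BackwardValid (v ∷ V) A → SPView k v V A
spView k {v} {V} {A} increasing valid with onArrow v A in touched
spView k {v} {[]}         increasing valid | false = single refl
spView k {v} {x ∷ xs} {A} increasing valid | false =
  isolated refl (BackwardValid-⊆ valid id within) (SP′-isolated k (Increasing-head∉ increasing) within)
  where
  within : ∀ {a} → a ∈ A → Within (x ∷ xs) a
  within a∈A with BackwardValid.within valid a∈A
  ... | here t≡v , _        = ⊥-elim (subst T touched (onArrow⁺ a∈A (inj₁ t≡v)))
  ... | _        , here h≡v = ⊥-elim (subst T touched (onArrow⁺ a∈A (inj₂ h≡v)))
  ... | there t∈ , there h∈ = t∈ , h∈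
spView k {v} {V} {A} increasing valid | true with first (filterᵇ (λ y → isArrow y v A) (v ∷ V)) in found
... | nothing = ⊥-elim (intoMin (onArrow⁻ (Equivalence.from T-≡ touched)))
  where
  intoMin : ¬ ∃ λ a → a ∈ A × Touches v a
  intoMin (a , a∈A , inj₁ t≡v) = min-not-tail increasing valid a∈A t≡v
  intoMin ((t , h) , a∈A , inj₂ refl) =
    first-filterᵇ-nothing (λ y → isArrow y v A) (v ∷ V) found (BackwardValid.tail∈ valid a∈A) (isArrow⁺ a∈A)
... | just w with first-filterᵇ-just _ (v ∷ V) found
... | [] , Q , refl , _ , vv = ⊥-elim (<-irrefl refl (BackwardValid.backward valid (isArrow⁻ vv)))
... | _ ∷ P , Q , eq , _ ∷ before , wv with ∷-injective eq
... | refl , refl = enclosed P w Q refl (isArrow⁻ wv) (λ y∈P → All.lookup before y∈P ∘ isArrow⁺)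
  (SP′-enclosed k P (increasing-split P increasing) (Equivalence.from T-≡ touched) found)

module _ {v P w Q A} (split : IncreasingSplit v P w Q) (valid : BackwardValid (v ∷ P ++ w ∷ Q) A)
         (wv∈A : (w , v) ∈ A) (before : ∀ {y} → y ∈ P → (y , v) ∉ A) where
  open BackwardValid valid

  private
    leaving : ∀ {t h} → (t , h) ∈ A → t ∈ P ∷ʳ w → h ≡ v ⊎ w < h → (t , h) ≡ (w , v)
    leaving a∈A t∈ (inj₂ w<h) = ⊥-elim (<⇒≱ (<-trans w<h (backward a∈A)) (proj₂ (inner-bounds split t∈)))
    leaving a∈A t∈ (inj₁ refl) with ∈-++⁻ P t∈
    ... | inj₁ t∈P         = ⊥-elim (before t∈P a∈A)
    ... | inj₂ (here refl) = refl

    -- An arrow entering (v, w] from beyond w would cross (w , v), or end at its tail.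
    entering : ∀ {t h} → (t , h) ∈ A → t ≡ v ⊎ w < t → v < h × h ≤ w → ⊥
    entering a∈A (inj₁ refl) (v<h , _)   = <-asym v<h (backward a∈A)
    entering a∈A (inj₂ w<t)  (v<h , h≤w) with m≤n⇒m<n∨m≡n h≤w
    ... | inj₁ h<w  = noncrossing wv∈A a∈A (v<h , h<w , w<t)
    ... | inj₂ refl = headNotTail a∈A wv∈A (λ eq → <-irrefl (sym (cong proj₁ eq)) w<t) refl

  enclosed-arrows : ∀ {a} → a ∈ A → a ≡ (w , v) ⊎ Within (P ∷ʳ w) a ⊎ Within (v ∷ Q) a
  enclosed-arrows a∈A with inner-or-outer split (tail∈ a∈A) | inner-or-outer split (head∈ a∈A)
  ... | inj₁ t∈ | inj₁ h∈ = inj₂ (inj₁ (t∈ , h∈))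
  ... | inj₂ t∈ | inj₂ h∈ = inj₂ (inj₂ (t∈ , h∈))
  ... | inj₁ t∈ | inj₂ h∈ = inj₁ (leaving a∈A t∈ (outer-bounds split h∈))
  ... | inj₂ t∈ | inj₁ h∈ = ⊥-elim (entering a∈A (outer-bounds split t∈) (inner-bounds split h∈))

  enclosed-⊆ : ∀ {B} → (w , v) ∈ B →
    restrict (P ∷ʳ w) A ⊆ restrict (P ∷ʳ w) B → restrict (v ∷ Q) A ⊆ restrict (v ∷ Q) B → A ⊆ B
  enclosed-⊆ wv∈B inner⊆ outer⊆ a∈A with enclosed-arrows a∈A
  ... | inj₁ refl        = wv∈B
  ... | inj₂ (inj₁ in∈)  = proj₁ (∈-restrict⁻ (P ∷ʳ w) (inner⊆ (∈-restrict⁺ (P ∷ʳ w) a∈A in∈)))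
  ... | inj₂ (inj₂ out∈) = proj₁ (∈-restrict⁻ (v ∷ Q) (outer⊆ (∈-restrict⁺ (v ∷ Q) a∈A out∈)))

module _ {v P w Q A₁ A₂} (split : IncreasingSplit v P w Q)
         (valid₁ : BackwardValid (P ∷ʳ w) A₁) (valid₂ : BackwardValid (v ∷ Q) A₂) where
  open IncreasingSplit split
  private
    module V₁ = BackwardValid valid₁
    module V₂ = BackwardValid valid₂

    ∈-enclosing⁻ : ∀ {a} → a ∈ (w , v) ∷ A₁ ++ A₂ → a ≡ (w , v) ⊎ a ∈ A₁ ⊎ a ∈ A₂
    ∈-enclosing⁻ (here refl) = inj₁ refl
    ∈-enclosing⁻ (there a∈)  = inj₂ (∈-++⁻ A₁ a∈)

    inner-arrow : ∀ {a} → a ∈ A₁ → v < head a × tail a ≤ w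
    inner-arrow a∈ = proj₁ (inner-bounds split (V₁.head∈ a∈)) , proj₂ (inner-bounds split (V₁.tail∈ a∈))

    outer-head : ∀ {a} → a ∈ A₂ → head a ≡ v ⊎ w < head a
    outer-head a∈ = outer-bounds split (V₂.head∈ a∈)

    outer-tail : ∀ {a} → a ∈ A₂ → w < tail a
    outer-tail a∈ with outer-bounds split (V₂.tail∈ a∈) | outer-head a∈
    ... | inj₂ w<t  | _        = w<t
    ... | inj₁ refl | inj₁ h≡v = ⊥-elim (<-irrefl h≡v (V₂.backward a∈))
    ... | inj₁ refl | inj₂ w<h = ⊥-elim (<-asym (V₂.backward a∈) (<-trans v<w w<h))

    within : ∀ {a} → a ∈ (w , v) ∷ A₁ ++ A₂ → Within (v ∷ P ++ w ∷ Q) a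
    within a∈ with ∈-enclosing⁻ a∈
    ... | inj₁ refl        = ∷ʳ⊆ v P w Q (∈-++⁺ʳ P (here refl)) , here refl
    ... | inj₂ (inj₁ a∈₁) = ∷ʳ⊆ v P w Q (V₁.tail∈ a∈₁) , ∷ʳ⊆ v P w Q (V₁.head∈ a∈₁)
    ... | inj₂ (inj₂ a∈₂) = ∷⊆ v P w Q (V₂.tail∈ a∈₂) , ∷⊆ v P w Q (V₂.head∈ a∈₂)

    backward : ∀ {a} → a ∈ (w , v) ∷ A₁ ++ A₂ → Backward a
    backward a∈ with ∈-enclosing⁻ a∈
    ... | inj₁ refl        = v<w
    ... | inj₂ (inj₁ a∈₁) = V₁.backward a∈₁
    ... | inj₂ (inj₂ a∈₂) = V₂.backward a∈₂

    noncrossing : ∀ {a b} → a ∈ (w , v) ∷ A₁ ++ A₂ → b ∈ (w , v) ∷ A₁ ++ A₂ → ¬ Crossing a b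
    noncrossing a∈ b∈ with ∈-enclosing⁻ a∈ | ∈-enclosing⁻ b∈
    ... | inj₁ refl        | inj₁ refl        = <-irrefl refl ∘ proj₁
    ... | inj₁ refl        | inj₂ (inj₁ b∈₁) = λ (_ , _ , w<t) → <⇒≱ w<t (proj₂ (inner-arrow b∈₁))
    ... | inj₁ refl        | inj₂ (inj₂ b∈₂) = λ (v<h , h<w , _) →
      [ (λ h≡v → <-irrefl (sym h≡v) v<h) , (λ w<h → <-asym w<h h<w) ]′ (outer-head b∈₂)
    ... | inj₂ (inj₁ a∈₁) | inj₁ refl        = λ (h<v , _) → <-asym h<v (proj₁ (inner-arrow a∈₁))
    ... | inj₂ (inj₂ a∈₂) | inj₁ refl        = λ (_ , _ , t<w) → <-asym t<w (outer-tail a∈₂)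
    ... | inj₂ (inj₁ a∈₁) | inj₂ (inj₁ b∈₁) = V₁.noncrossing a∈₁ b∈₁
    ... | inj₂ (inj₂ a∈₂) | inj₂ (inj₂ b∈₂) = V₂.noncrossing a∈₂ b∈₂
    ... | inj₂ (inj₁ a∈₁) | inj₂ (inj₂ b∈₂) = λ (ha<hb , hb<ta , _) →
      [ (λ hb≡v → <-asym (subst (_ <_) hb≡v ha<hb) (proj₁ (inner-arrow a∈₁)))
      , (λ w<hb → <⇒≱ (<-trans w<hb hb<ta) (proj₂ (inner-arrow a∈₁))) ]′ (outer-head b∈₂)
    ... | inj₂ (inj₂ a∈₂) | inj₂ (inj₁ b∈₁) = λ (_ , _ , ta<tb) →
      <⇒≱ (<-trans (outer-tail a∈₂) ta<tb) (proj₂ (inner-arrow b∈₁))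

    headNotTail : ∀ {a b} → a ∈ (w , v) ∷ A₁ ++ A₂ → b ∈ (w , v) ∷ A₁ ++ A₂ → a ≢ b → head a ≢ tail b
    headNotTail a∈ b∈ a≢b with ∈-enclosing⁻ a∈ | ∈-enclosing⁻ b∈
    ... | inj₁ refl        | inj₁ refl        = ⊥-elim (a≢b refl)
    ... | inj₁ refl        | inj₂ (inj₁ b∈₁) = λ v≡t →
      <-asym (proj₁ (inner-arrow b∈₁)) (subst (_ <_) (sym v≡t) (V₁.backward b∈₁))
    ... | inj₁ refl        | inj₂ (inj₂ b∈₂) = λ v≡t → <-asym v<w (subst (w <_) (sym v≡t) (outer-tail b∈₂))
    ... | inj₂ (inj₁ a∈₁) | inj₁ refl        = λ h≡w →
      <⇒≱ (subst (_< _) h≡w (V₁.backward a∈₁)) (proj₂ (inner-arrow a∈₁))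
    ... | inj₂ (inj₂ a∈₂) | inj₁ refl        = λ h≡w →
      [ (λ h≡v → <-irrefl (trans (sym h≡v) h≡w) v<w) , (λ w<h → <-irrefl (sym h≡w) w<h) ]′ (outer-head a∈₂)
    ... | inj₂ (inj₁ a∈₁) | inj₂ (inj₁ b∈₁) = V₁.headNotTail a∈₁ b∈₁ a≢b
    ... | inj₂ (inj₂ a∈₂) | inj₂ (inj₂ b∈₂) = V₂.headNotTail a∈₂ b∈₂ a≢b
    ... | inj₂ (inj₁ a∈₁) | inj₂ (inj₂ b∈₂) = λ h≡t →
      <⇒≱ (subst (w <_) (sym h≡t) (outer-tail b∈₂))
          (≤-trans (<⇒≤ (V₁.backward a∈₁)) (proj₂ (inner-arrow a∈₁)))
    ... | inj₂ (inj₂ a∈₂) | inj₂ (inj₁ b∈₁) = λ h≡t →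
      [ (λ h≡v → <-asym (proj₁ (inner-arrow b∈₁)) (subst (_ <_) (trans (sym h≡t) h≡v) (V₁.backward b∈₁)))
      , (λ w<h → <⇒≱ (subst (w <_) h≡t w<h) (proj₂ (inner-arrow b∈₁))) ]′ (outer-head a∈₂)

  enclose-valid : BackwardValid (v ∷ P ++ w ∷ Q) ((w , v) ∷ A₁ ++ A₂)
  enclose-valid = record
    { within = within ; backward = backward ; noncrossing = noncrossing ; headNotTail = headNotTail }

  private
    restrict-inner : restrict (P ∷ʳ w) ((w , v) ∷ A₁ ++ A₂) ≡ A₁
    restrict-inner = begin
        restrict (P ∷ʳ w) ((w , v) ∷ A₁ ++ A₂)
      ≡⟨ restrict-++ (P ∷ʳ w) ((w , v) ∷ []) (A₁ ++ A₂) ⟩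
        restrict (P ∷ʳ w) ((w , v) ∷ []) ++ restrict (P ∷ʳ w) (A₁ ++ A₂)
      ≡⟨ cong₂ _++_ (restrict-none (P ∷ʳ w) {(w , v) ∷ []}
                      λ { (here refl) (_ , v∈) → inner∉outer split v∈ (here refl) })
                    (restrict-++ (P ∷ʳ w) A₁ A₂) ⟩
        restrict (P ∷ʳ w) A₁ ++ restrict (P ∷ʳ w) A₂
      ≡⟨ cong₂ _++_ (restrict-all (P ∷ʳ w) V₁.within)
                    (restrict-none (P ∷ʳ w) λ a∈₂ (t∈ , _) → inner∉outer split t∈ (V₂.tail∈ a∈₂)) ⟩
        A₁ ++ []
      ≡⟨ ++-identityʳ A₁ ⟩
        A₁
      ∎
      where open ≡-Reasoning

    restrict-outer : restrict (v ∷ Q) ((w , v) ∷ A₁ ++ A₂) ≡ A₂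
    restrict-outer = begin
        restrict (v ∷ Q) ((w , v) ∷ A₁ ++ A₂)
      ≡⟨ restrict-++ (v ∷ Q) ((w , v) ∷ []) (A₁ ++ A₂) ⟩
        restrict (v ∷ Q) ((w , v) ∷ []) ++ restrict (v ∷ Q) (A₁ ++ A₂)
      ≡⟨ cong₂ _++_ (restrict-none (v ∷ Q) {(w , v) ∷ []}
                      λ { (here refl) (w∈ , _) → inner∉outer split w∈inner w∈ })
                    (restrict-++ (v ∷ Q) A₁ A₂) ⟩
        restrict (v ∷ Q) A₁ ++ restrict (v ∷ Q) A₂
      ≡⟨ cong₂ _++_ (restrict-none (v ∷ Q) λ a∈₁ (t∈ , _) → inner∉outer split (V₁.tail∈ a∈₁) t∈)
                    (restrict-all (v ∷ Q) V₂.within) ⟩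
        A₂
      ∎
      where
      open ≡-Reasoning
      w∈inner : w ∈ P ∷ʳ w
      w∈inner = ∈-++⁺ʳ P (here refl)

    v∷P<w : ∀ {y} → y ∈ v ∷ P → y < w
    v∷P<w (here refl)  = v<w
    v∷P<w (there y∈P) = All.lookup P<w y∈P

    w-least : ∀ {y} → y ∈ v ∷ P → (y , v) ∉ (w , v) ∷ A₁ ++ A₂
    w-least y∈ yv∈ with ∈-enclosing⁻ yv∈
    ... | inj₁ refl        = <-irrefl refl (v∷P<w y∈)
    ... | inj₂ (inj₁ a∈₁) = <-irrefl refl (proj₁ (inner-arrow a∈₁))
    ... | inj₂ (inj₂ a∈₂) = <-asym (outer-tail a∈₂) (v∷P<w y∈)

  SP′-enclose : ∀ k →
    SP′ (suc k) (v ∷ P ++ w ∷ Q) ((w , v) ∷ A₁ ++ A₂) ≡ U ∷ SP′ k (P ∷ʳ w) A₁ ++ D ∷ SP′ k (v ∷ Q) A₂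
  SP′-enclose k = trans
    (SP′-enclosed k P split (onArrow⁺ {a = w , v} {(w , v) ∷ A₁ ++ A₂} (here refl) (inj₂ refl))
      (first-filterᵇ-++ _ (v ∷ P) Q (All.tabulate λ y∈ → w-least y∈ ∘ isArrow⁻)
        (isArrow⁺ {w} {v} {(w , v) ∷ A₁ ++ A₂} (here refl))))
    (cong₂ (λ B₁ B₂ → U ∷ SP′ k (P ∷ʳ w) B₁ ++ D ∷ SP′ k (v ∷ Q) B₂) restrict-inner restrict-outer)

shorter-fuel : ∀ {m n k} → m < n → n ≤ suc k → m ≤ k
shorter-fuel m<n n≤ = ≤-pred (<-≤-trans m<n n≤)

H∷≢U∷ : ∀ {s t : Word} → H ∷ s ≢ U ∷ t
H∷≢U∷ ()

SP′-schroder : ∀ k V {A n} → Increasing V → length V ≤ k → length V ≡ suc n → BackwardValid V A →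
  Schroder n (SP′ k V A)

SP′-schroder-inner : ∀ k {v V P w Q A} → V ≡ P ++ w ∷ Q → Increasing (v ∷ V) → length (v ∷ V) ≤ suc k →
  BackwardValid (v ∷ V) A → Schroder (length P) (SP′ k (P ∷ʳ w) (restrict (P ∷ʳ w) A))

SP′-schroder _       []      _ _ () _
SP′-schroder zero    (_ ∷ _) _ () _ _
SP′-schroder (suc k) (v ∷ V) {A} increasing fuel refl valid with spView k increasing valid
... | single refl = refl , refl
... | isolated refl valid′ eq =
  subst (Schroder (length V)) (sym eq)
    (Schroder-H {s = SP′ k V A} (SP′-schroder k V {A} (AllPairs.tail increasing) (≤-pred fuel) refl valid′))
... | enclosed P w Q refl _ _ eq =
  subst₂ Schroder (sym (length-++ P)) (sym eq)
    (Schroder-UD {length P} {length Q} {inner-word} {outer-word} inner outer)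
  where
  inner-word outer-word : Word
  inner-word = SP′ k (P ∷ʳ w) (restrict (P ∷ʳ w) A)
  outer-word = SP′ k (v ∷ Q) (restrict (v ∷ Q) A)
  inner : Schroder (length P) inner-word
  inner = SP′-schroder-inner k refl increasing fuel valid
  outer : Schroder (length Q) outer-word
  outer = SP′-schroder k (v ∷ Q) (IncreasingSplit.outer↑ (increasing-split P increasing))
            (shorter-fuel (∷-shorter v P w Q) fuel) refl (BackwardValid-restrict (v ∷ Q) valid)

SP′-schroder-inner k {v} {P = P} {w} {Q} refl increasing fuel valid =
  SP′-schroder k (P ∷ʳ w) (IncreasingSplit.inner↑ (increasing-split P increasing))
    (shorter-fuel (∷ʳ-shorter v P w Q) fuel) (length-∷ʳ P w) (BackwardValid-restrict (P ∷ʳ w) valid)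

SP′-⊆ : ∀ k V {A B} → Increasing V → length V ≤ k → BackwardValid V A → BackwardValid V B →
  SP′ k V A ≡ SP′ k V B → A ⊆ B
SP′-⊆ _ [] _ _ validA _ _ a∈A with BackwardValid.tail∈ validA a∈A
... | ()
SP′-⊆ zero (_ ∷ _) _ () _ _ _
SP′-⊆ (suc k) (v ∷ V) {A} {B} increasing fuel validA validB same a∈A
  with spView k increasing validA | spView k increasing validB
... | single refl                 | _                        = ⊥-elim (BackwardValid-singleton validA a∈A)
... | isolated refl _ _           | single ()
... | enclosed P w Q refl _ _ _   | single eq                = ⊥-elim (case ++-conicalʳ P (w ∷ Q) eq of λ ())
... | isolated refl _ eqA         | enclosed _ _ _ _ _ _ eqB =
  ⊥-elim (H∷≢U∷ (trans (sym eqA) (trans same eqB)))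
... | enclosed _ _ _ refl _ _ eqA | isolated _ _ eqB         =
  ⊥-elim (H∷≢U∷ (trans (sym eqB) (trans (sym same) eqA)))
... | isolated refl validA′ eqA   | isolated _ validB′ eqB   =
  SP′-⊆ k V (AllPairs.tail increasing) (≤-pred fuel) validA′ validB′
    (∷-injectiveʳ (trans (sym eqA) (trans same eqB))) a∈A
... | enclosed P w Q refl wv∈A before eqA | enclosed P′ _ _ split′ wv∈B _ eqB
  with Schroder-UD-injective (SP′-schroder-inner k {A = A} refl increasing fuel validA)
                             (SP′-schroder-inner k {A = B} split′ increasing fuel validB)
                             (trans (sym eqA) (trans same eqB))
... | |P|≡|P′| , same-inner , same-outer with ++-∷-injective P P′ |P|≡|P′| split′
... | refl , refl , refl =
  enclosed-⊆ split validA wv∈A before wv∈B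
    (SP′-⊆ k (P ∷ʳ w) inner↑ (shorter-fuel (∷ʳ-shorter v P w Q) fuel)
      (BackwardValid-restrict (P ∷ʳ w) validA) (BackwardValid-restrict (P ∷ʳ w) validB) same-inner)
    (SP′-⊆ k (v ∷ Q) outer↑ (shorter-fuel (∷-shorter v P w Q) fuel)
      (BackwardValid-restrict (v ∷ Q) validA) (BackwardValid-restrict (v ∷ Q) validB) same-outer)
    a∈A
  where
  split = increasing-split P increasing
  open IncreasingSplit split

SP′-surjective : ∀ k V {n s} → Increasing V → length V ≤ k → length V ≡ suc n → Schroder n s →
  ∃ λ A → BackwardValid V A × SP′ k V A ≡ s
SP′-surjective _       []       _ _ () _
SP′-surjective zero    (_ ∷ _)  _ () _ _
SP′-surjective (suc k) (v ∷ []) _ _ refl schroder = [] , BackwardValid-[] , sym (Schroder-zero schroder)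
SP′-surjective (suc k) (v ∷ x ∷ xs) {s = H ∷ r} increasing fuel refl schroder
  with SP′-surjective k (x ∷ xs) {s = r} (AllPairs.tail increasing) (≤-pred fuel) refl
         (Schroder-H⁻ {s = r} schroder)
... | A , valid , refl =
  A , BackwardValid-⊆ valid id (Product.map there there ∘ within)
    , SP′-isolated k (Increasing-head∉ increasing) within
  where open BackwardValid valid using (within)
SP′-surjective (suc k) (v ∷ V) {s = U ∷ r} increasing fuel refl schroder with Schroder-UD⁻ {r = r} schroder
... | i , j , s₁ , s₂ , refl , schroder₁ , schroder₂ , i+1+j≡n
  with split-at i V (subst (i <_) i+1+j≡n (m<m+n i (s≤s z≤n)))
... | P , w , Q , refl , refl
  with SP′-surjective k (P ∷ʳ w) {s = s₁} (IncreasingSplit.inner↑ (increasing-split P increasing))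
         (shorter-fuel (∷ʳ-shorter v P w Q) fuel) (length-∷ʳ P w) schroder₁
     | SP′-surjective k (v ∷ Q) {s = s₂} (IncreasingSplit.outer↑ (increasing-split P increasing))
         (shorter-fuel (∷-shorter v P w Q) fuel)
         (+-cancelˡ-≡ (length P) _ _ (trans (sym (length-++ P)) (sym i+1+j≡n))) schroder₂
... | A₁ , valid₁ , refl | A₂ , valid₂ , refl =
  (w , v) ∷ A₁ ++ A₂ , enclose-valid split valid₁ valid₂ , SP′-enclose split valid₁ valid₂ k
  where split = increasing-split P increasing
SP′-surjective (suc k) (v ∷ _ ∷ _) {s = []}    _ _ refl (() , _)
SP′-surjective (suc k) (v ∷ _ ∷ _) {s = D ∷ _} _ _ refl (_ , ())

proposition8p4 : (n : ℕ) (V : List ℕ)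
    → All (λ x → 0 < x) V
    → Linked _<_ V
    → length V ≡ suc n
    → (∀ A → BackwardValidDigraph V A → Schroder n (SP V A))
      × (∀ A B → BackwardValidDigraph V A → BackwardValidDigraph V B
           → SP V A ≡ SP V B → ∀ a → (a ∈ A) ⇔ (a ∈ B))
      × (∀ w → Schroder n w → ∃ λ A → BackwardValidDigraph V A × SP V A ≡ w)
proposition8p4 n V _ linked len =
    (λ A valid → SP′-schroder (length V) V increasing ≤-refl len (valid⁺ valid))
  , (λ A B validA validB same a →
       mk⇔ (SP′-⊆ (length V) V increasing ≤-refl (valid⁺ validA) (valid⁺ validB) same)
           (SP′-⊆ (length V) V increasing ≤-refl (valid⁺ validB) (valid⁺ validA) (sym same)))
  , (λ w schroder → Product.map₂ (Product.map₁ BackwardValid⇒BackwardValidDigraph)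
                      (SP′-surjective (length V) V increasing ≤-refl len schroder))
  where
  increasing : Increasing V
  increasing = Linked⇒AllPairs <-trans linked
  valid⁺ : ∀ {A} → BackwardValidDigraph V A → BackwardValid V A
  valid⁺ = BackwardValidDigraph⇒BackwardValid
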